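{- Let $k\ge 2$, $d=2k-1$, $m\ge 2$ an integer, and let $a_i,b_i$ ($1\le i\le k-1$) be positive integers with $a_i+b_i=m$ and $\gcd(a_i,m)=1$. Let $P=\mathrm{conv}\{\mathbf{0},\mathbf{e}_1,\ldots,\mathbf{e}_{d-1},v_d\}\subset\mathbb{R}^d$ with $v_d=\sum_{i=1}^{k-1}a_i\mathbf{e}_i+\sum_{j=k}^{d-1}b_{d-j}\mathbf{e}_j+m\mathbf{e}_d$, and let $A=\{x_1+\cdots+x_k : x_1,\ldots,x_k\in P\cap\mathbb{Z}^d\}$. For $1\le i\le m-1$ let $$w_i=\left(\frac{\overline{ib_1}+ia_1}{m},\ldots,\frac{\overline{ib_{k-1}}+ia_{k-1}}{m},\frac{\overline{ia_{k-1}}+ib_{k-1}}{m},\ldots,\frac{\overline{ia_1}+ib_1}{m},\,i\right)\in\mathbb{R}^d,$$ where $\overline{\ell}$ denotes the remainder of $\ell$ upon division by $m$. Then for every $2\le i\le m-2$ there exist $v,v'\in A$ such that $$w_{i-1}+w_{i+1}-2w_i=v-v' \quad\text{and}\quad w_{m-(i-1)}+w_{m-(i+1)}-2w_{m-i}=v'-v.$$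
   Context: $\mathbf{e}_1,\ldots,\mathbf{e}_d$ are the standard unit vectors and $\mathbf{0}$ the origin; the first $k-1$ coordinates of $w_i$ involve $a_1,\dots,a_{k-1}$ in increasing index order, and the next $k-1$ coordinates involve $a_{k-1},\dots,a_1$ in decreasing index order. -}

module Defs where

open import Data.Nat as ℕ using (ℕ; zero; suc; _∸_; _≤ᵇ_; _≡ᵇ_)
open import Data.Nat.DivMod using (_%_)
open import Data.Integer as ℤ using (ℤ; +_)
open import Data.Rational as ℚ using (ℚ; 0ℚ; 1ℚ; _/_)
open import Data.Fin using (Fin; toℕ)
import Data.Fin as Fin
open import Data.Bool using (if_then_else_)
open import Data.Product using (Σ; _×_)
open import Relation.Binary.PropositionalEquality using (_≡_)

toℚ : ℤ → ℚ
toℚ z = z / 1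

-- remainder of ℓ upon division by m  (m ≥ 2 in the theorem; m = 0 case is a dummy)
rem : ℕ → ℕ → ℕ
rem ℓ zero = ℓ
rem ℓ (suc n) = ℓ % suc n

-- n / m as a rational (m ≥ 2 in the theorem; m = 0 case is a dummy)
frac : ℕ → ℕ → ℚ
frac n zero = 0ℚ
frac n (suc m) = (+ n) / suc m

sumℚ : ∀ {n} → (Fin n → ℚ) → ℚ
sumℚ {zero} f = 0ℚ
sumℚ {suc n} f = f Fin.zero ℚ.+ sumℚ (λ j → f (Fin.suc j))

sumℤ : ∀ {n} → (Fin n → ℤ) → ℤ
sumℤ {zero} f = + 0
sumℤ {suc n} f = f Fin.zero ℤ.+ sumℤ (λ j → f (Fin.suc j))

dim : ℕ → ℕ
dim k = 2 ℕ.* k ∸ 1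

-- Sequences a, b are indexed 1..k-1 (values outside that range are irrelevant).
-- Coordinates of ℝ^d are 0-indexed: coordinate index c corresponds to e_{c+1}.

vdCoord : (k m : ℕ) (a b : ℕ → ℕ) → ℕ → ℕ
vdCoord k m a b c =
  let j = suc c ; d = dim k in
  if j ≤ᵇ (k ∸ 1) then a j
  else if j ≤ᵇ (d ∸ 1) then b (d ∸ j)
  else m

vertex : (k m : ℕ) (a b : ℕ → ℕ) → Fin (suc (dim k)) → Fin (dim k) → ℚ
vertex k m a b t c =
  if toℕ t ≡ᵇ 0 then 0ℚ
  else if toℕ t ≡ᵇ dim k then toℚ (+ vdCoord k m a b (toℕ c))
  else (if toℕ t ≡ᵇ suc (toℕ c) then 1ℚ else 0ℚ)

-- x ∈ P = conv{0, e_1, …, e_{d-1}, v_d}: x is a convex combination of the vertices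
-- (rational coefficients suffice since the vertices are rational and affinely independent,
--  and only integer points x are ever tested)
InP : (k m : ℕ) (a b : ℕ → ℕ) → (Fin (dim k) → ℚ) → Set
InP k m a b x =
  Σ (Fin (suc (dim k)) → ℚ) λ λs →
    (∀ t → 0ℚ ℚ.≤ λs t) ×
    (sumℚ λs ≡ 1ℚ) ×
    (∀ c → x c ≡ sumℚ (λ t → λs t ℚ.* vertex k m a b t c))

InA : (k m : ℕ) (a b : ℕ → ℕ) → (Fin (dim k) → ℤ) → Set
InA k m a b v =
  Σ (Fin k → Fin (dim k) → ℤ) λ xs →
    (∀ j → InP k m a b (λ c → toℚ (xs j c))) ×
    (∀ c → v c ≡ sumℤ (λ j → xs j c))

wCoord : (k m : ℕ) (a b : ℕ → ℕ) → ℕ → ℕ → ℚ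
wCoord k m a b i c =
  let j = suc c ; d = dim k in
  if j ≤ᵇ (k ∸ 1) then frac (rem (i ℕ.* b j) m ℕ.+ i ℕ.* a j) m
  else if j ≤ᵇ (d ∸ 1) then frac (rem (i ℕ.* a (d ∸ j)) m ℕ.+ i ℕ.* b (d ∸ j)) m
  else toℚ (+ i)

w : (k m : ℕ) (a b : ℕ → ℕ) → ℕ → Fin (dim k) → ℚ
w k m a b i c = wCoord k m a b i (toℕ c)

-- For 0 < j < m and a pair a + b = m with gcd(a, m) = 1, m divides neither j a nor j b and their
-- remainders add up to m. Hence the coordinate (rem(j b) + j a)/m of w_j is the integer 1 + ⌊j a/m⌋,
-- its mirror (rem(j a) + j b)/m equals 1 + ⌊j b/m⌋ = j - ⌊j a/m⌋, and the last coordinate is j.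
-- So w_{i-1} + w_{i+1} - 2 w_i has the entries u, -u on the two coordinates of each pair and 0 on
-- the last one, where u ∈ {-1, 0, 1} is the second difference of j ↦ ⌊j a/m⌋ (it grows by at most 1
-- per step since a ≤ m). Choosing e_p or e_{d-p} according to the sign of u for every pair (and the
-- origin for the k-th summand) gives v ∈ A, and the opposite choices give v' ∈ A with v - v' equal to
-- that second difference. Finally ⌊j a/m⌋ + ⌊(m - j) a/m⌋ = a - 1, so every coordinate of
-- w_j + w_{m-j} is constant in j and the second difference at m - i is the negative of the one at i.
module Submission where

open import Algebra.Bundles using (Monoid)
import Algebra.Properties.Monoid.Sum
open import Data.Bool using (true; false; if_then_else_)
open import Data.Bool.Properties using (if-float)
open import Data.Fin as Fin using (Fin; toℕ; fromℕ<; opposite)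
import Data.Fin.Properties as Finₚ
open import Data.Integer as ℤ using (ℤ; +_; -[1+_])
import Data.Integer.Properties as ℤₚ
import Data.Integer.Tactic.RingSolver as ℤ-Solver
open import Data.Nat as ℕ using (ℕ; zero; suc; _+_; _*_; _∸_; _≤_; _<_; _≡ᵇ_; _≟_; z≤n; s≤s; NonZero)
import Data.Nat.Properties as ℕₚ
open import Data.Nat.Coprimality as Coprime using (coprime-divisor; gcd≡1⇒coprime)
open import Data.Nat.DivMod using (_/_; _%_; m≡m%n+[m/n]*n; m%n<n; /-monoˡ-≤; m/n≡1+[m∸n]/n)
open import Data.Nat.Divisibility using (_∣_; ∣⇒≤; m%n≡0⇒n∣m)
open import Data.Nat.GCD using (gcd)
import Data.Nat.Tactic.RingSolver as ℕ-Solver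
open import Data.Product using (Σ; _×_; _,_; proj₁; proj₂; swap)
open import Data.Rational as ℚ using (ℚ; 0ℚ; 1ℚ)
import Data.Rational.Properties as ℚₚ
open import Data.Rational.Unnormalised as ℚᵘ using (mkℚᵘ; *≡*)
import Data.Rational.Unnormalised.Properties as ℚᵘₚ
open import Data.Sum using (inj₁; inj₂; [_,_]′)
open import Function using (_∘_)
open import Relation.Nullary using (yes; no)
open import Relation.Nullary.Decidable using (dec-true; dec-false)
open import Relation.Binary.PropositionalEquality
open import Defs

module _ {c ℓ} (M : Monoid c ℓ) where
  open Monoid M renaming (refl to ≈-refl; trans to ≈-trans)
  open Algebra.Properties.Monoid.Sum M using (sum)

  sum-zero : ∀ {n} (f : Fin n → Carrier) → (∀ i → f i ≈ ε) → sum f ≈ ε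
  sum-zero {zero}  f f≈ε = ≈-refl
  sum-zero {suc n} f f≈ε =
    ≈-trans (∙-cong (f≈ε Fin.zero) (sum-zero (f ∘ Fin.suc) (f≈ε ∘ Fin.suc))) (identityˡ ε)

  sum-single : ∀ {n} (f : Fin n → Carrier) i → (∀ j → j ≢ i → f j ≈ ε) → sum f ≈ f i
  sum-single f Fin.zero    others =
    ≈-trans (∙-congˡ (sum-zero _ (λ j → others (Fin.suc j) λ ()))) (identityʳ _)
  sum-single f (Fin.suc i) others =
    ≈-trans (∙-congʳ (others Fin.zero λ ()))
      (≈-trans (identityˡ _) (sum-single (f ∘ Fin.suc) i (λ j j≢i → others (Fin.suc j) (j≢i ∘ Finₚ.suc-injective))))

module ℤSum = Algebra.Properties.Monoid.Sum ℤₚ.+-0-monoid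
module ℚSum = Algebra.Properties.Monoid.Sum ℚₚ.+-0-monoid

sumℤ≡sum : ∀ {n} (f : Fin n → ℤ) → sumℤ f ≡ ℤSum.sum f
sumℤ≡sum {zero}  f = refl
sumℤ≡sum {suc n} f = cong (ℤ._+_ (f Fin.zero)) (sumℤ≡sum (f ∘ Fin.suc))

sumℚ≡sum : ∀ {n} (f : Fin n → ℚ) → sumℚ f ≡ ℚSum.sum f
sumℚ≡sum {zero}  f = refl
sumℚ≡sum {suc n} f = cong (ℚ._+_ (f Fin.zero)) (sumℚ≡sum (f ∘ Fin.suc))

sumℤ-zero : ∀ {n} (f : Fin n → ℤ) → (∀ i → f i ≡ + 0) → sumℤ f ≡ + 0
sumℤ-zero f f≡0 = trans (sumℤ≡sum f) (sum-zero ℤₚ.+-0-monoid f f≡0)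

sumℤ-single : ∀ {n} (f : Fin n → ℤ) i → (∀ j → j ≢ i → f j ≡ + 0) → sumℤ f ≡ f i
sumℤ-single f i others = trans (sumℤ≡sum f) (sum-single ℤₚ.+-0-monoid f i others)

sumℚ-single : ∀ {n} (f : Fin n → ℚ) i → (∀ j → j ≢ i → f j ≡ 0ℚ) → sumℚ f ≡ f i
sumℚ-single f i others = trans (sumℚ≡sum f) (sum-single ℚₚ.+-0-monoid f i others)

toℚᵘ-toℚ : ∀ x → ℚ.toℚᵘ (toℚ x) ℚᵘ.≃ mkℚᵘ x 0
toℚᵘ-toℚ x = ℚₚ.toℚᵘ-fromℚᵘ (mkℚᵘ x 0)

toℚ-+ : ∀ x y → toℚ (x ℤ.+ y) ≡ toℚ x ℚ.+ toℚ y
toℚ-+ x y = ℚₚ.toℚᵘ-injective (begin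
  ℚ.toℚᵘ (toℚ (x ℤ.+ y))               ≈⟨ toℚᵘ-toℚ (x ℤ.+ y) ⟩
  mkℚᵘ (x ℤ.+ y) 0
    ≈⟨ *≡* (cong (ℤ._* + 1) (cong₂ ℤ._+_ (sym (ℤₚ.*-identityʳ x)) (sym (ℤₚ.*-identityʳ y)))) ⟩
  mkℚᵘ x 0 ℚᵘ.+ mkℚᵘ y 0               ≈⟨ ℚᵘₚ.≃-sym (ℚᵘₚ.+-cong (toℚᵘ-toℚ x) (toℚᵘ-toℚ y)) ⟩
  ℚ.toℚᵘ (toℚ x) ℚᵘ.+ ℚ.toℚᵘ (toℚ y)  ≈⟨ ℚᵘₚ.≃-sym (ℚₚ.toℚᵘ-homo-+ (toℚ x) (toℚ y)) ⟩
  ℚ.toℚᵘ (toℚ x ℚ.+ toℚ y)            ∎)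
  where open ℚᵘₚ.≃-Reasoning

toℚ-neg : ∀ x → toℚ (ℤ.- x) ≡ ℚ.- toℚ x
toℚ-neg x = ℚₚ.toℚᵘ-injective (ℚᵘₚ.≃-trans (toℚᵘ-toℚ (ℤ.- x))
  (ℚᵘₚ.≃-sym (ℚᵘₚ.≃-trans (ℚₚ.toℚᵘ-homo‿- (toℚ x)) (ℚᵘₚ.-‿cong (toℚᵘ-toℚ x)))))

toℚ-- : ∀ x y → toℚ (x ℤ.- y) ≡ toℚ x ℚ.- toℚ y
toℚ-- x y = trans (toℚ-+ x (ℤ.- y)) (cong (ℚ._+_ (toℚ x)) (toℚ-neg y))

frac-multiple : ∀ q M → frac (q * suc M) (suc M) ≡ toℚ (+ q)
frac-multiple q M = ℚₚ.fromℚᵘ-cong {mkℚᵘ (+ (q * suc M)) M} {mkℚᵘ (+ q) 0}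
  (*≡* (trans (ℤₚ.*-identityʳ (+ (q * suc M))) (ℤₚ.pos-* q (suc M))))

module _ (m : ℕ) .{{_ : NonZero m}} where

  %-/-complement : ∀ x y s → x + y ≡ s * m → 0 < x % m →
                   x % m + y % m ≡ m × suc (x / m + y / m) ≡ s
  %-/-complement x y s x+y≡s*m 0<r = r+r'≡m , 1+q≡s
    where
    r = x % m
    r' = y % m
    q = x / m + y / m
    split : r + r' + q * m ≡ s * m
    split = begin
      r + r' + (x / m + y / m) * m        ≡⟨ regroup r r' (x / m) (y / m) m ⟩
      (r + x / m * m) + (r' + y / m * m)  ≡⟨ cong₂ _+_ (sym (m≡m%n+[m/n]*n x m)) (sym (m≡m%n+[m/n]*n y m)) ⟩
      x + y                               ≡⟨ x+y≡s*m ⟩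
      s * m                               ∎
      where
      open ≡-Reasoning
      regroup : ∀ r r' a b m → r + r' + (a + b) * m ≡ (r + a * m) + (r' + b * m)
      regroup = ℕ-Solver.solve-∀
    q<s : q < s
    q<s = ℕₚ.*-cancelʳ-< m q s (begin-strict
      q * m            <⟨ ℕₚ.m<n+m (q * m) (ℕₚ.<-≤-trans 0<r (ℕₚ.m≤m+n r r')) ⟩
      r + r' + q * m   ≡⟨ split ⟩
      s * m            ∎)
      where open ℕₚ.≤-Reasoning
    s<2+q : s < 2 + q
    s<2+q = ℕₚ.*-cancelʳ-< m s (2 + q) (begin-strict
      s * m            ≡⟨ split ⟨
      r + r' + q * m   <⟨ ℕₚ.+-monoˡ-< (q * m) (ℕₚ.+-mono-< (m%n<n x m) (m%n<n y m)) ⟩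
      m + m + q * m    ≡⟨ collect m q ⟩
      (2 + q) * m      ∎)
      where
      open ℕₚ.≤-Reasoning
      collect : ∀ m q → m + m + q * m ≡ (2 + q) * m
      collect = ℕ-Solver.solve-∀
    1+q≡s : suc q ≡ s
    1+q≡s = ℕₚ.≤-antisym q<s (ℕₚ.≤-pred s<2+q)
    r+r'≡m : r + r' ≡ m
    r+r'≡m = ℕₚ.+-cancelʳ-≡ (q * m) (r + r') m (trans split (cong (_* m) (sym 1+q≡s)))

  %-complement-pos : ∀ x y s → x + y ≡ s * m → 0 < x % m → 0 < y % m
  %-complement-pos x y s x+y≡s*m 0<r = ℕₚ.n≢0⇒n>0 λ r'≡0 →
    ℕₚ.<⇒≢ (m%n<n x m) (trans (sym (ℕₚ.+-identityʳ (x % m)))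
      (trans (cong (_+_ (x % m)) (sym r'≡0)) (proj₁ (%-/-complement x y s x+y≡s*m 0<r))))

  gcd≡1⇒0<*% : ∀ {x j} → gcd x m ≡ 1 → 0 < j → j < m → 0 < j * x % m
  gcd≡1⇒0<*% {x} {j} gcd≡1 0<j j<m = ℕₚ.n≢0⇒n>0 λ r≡0 →
    ℕₚ.<⇒≱ j<m (∣⇒≤ {{ℕ.>-nonZero 0<j}} (coprime-divisor (Coprime.sym (gcd≡1⇒coprime {x} {m} gcd≡1))
      (subst (m ∣_) (ℕₚ.*-comm j x) (m%n≡0⇒n∣m (j * x) m r≡0))))

  *-complement : ∀ {x y} → x + y ≡ m → ∀ j → j * x + j * y ≡ j * m
  *-complement {x} {y} x+y≡m j = trans (sym (ℕₚ.*-distribˡ-+ j x y)) (cong (j *_) x+y≡m)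

  -- ⌈ j x / m ⌉ when m does not divide j x, which is the only case used
  ceilFrac : ℕ → ℕ → ℕ
  ceilFrac x j = suc (j * x / m)

  ceilFrac-numerator : ∀ {x y} → x + y ≡ m → ∀ j → 0 < j * x % m → j * y % m + j * x ≡ ceilFrac x j * m
  ceilFrac-numerator {x} {y} x+y≡m j 0<r = begin
    j * y % m + j * x                         ≡⟨ cong (_+_ (j * y % m)) (m≡m%n+[m/n]*n (j * x) m) ⟩
    j * y % m + (j * x % m + j * x / m * m)   ≡⟨ ℕₚ.+-assoc (j * y % m) (j * x % m) _ ⟨
    j * y % m + j * x % m + j * x / m * m     ≡⟨ cong (_+ j * x / m * m) remainders ⟩
    m + j * x / m * m                         ∎
    where
    open ≡-Reasoning
    remainders : j * y % m + j * x % m ≡ m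
    remainders = trans (ℕₚ.+-comm (j * y % m) (j * x % m))
      (proj₁ (%-/-complement (j * x) (j * y) j (*-complement x+y≡m j) 0<r))

  ceilFrac-+-/ : ∀ {x y} → x + y ≡ m → ∀ j → 0 < j * x % m → ceilFrac x j + j * y / m ≡ j
  ceilFrac-+-/ {x} {y} x+y≡m j 0<r = proj₂ (%-/-complement (j * x) (j * y) j (*-complement x+y≡m j) 0<r)

  ceilFrac-reflect : ∀ x {j} → j ≤ m → 0 < j * x % m → ceilFrac x j + ceilFrac x (m ∸ j) ≡ suc x
  ceilFrac-reflect x {j} j≤m 0<r = trans (ℕₚ.+-suc (ceilFrac x j) _)
    (cong suc (proj₂ (%-/-complement (j * x) ((m ∸ j) * x) x j*x+[m∸j]*x≡x*m 0<r)))
    where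
    j*x+[m∸j]*x≡x*m : j * x + (m ∸ j) * x ≡ x * m
    j*x+[m∸j]*x≡x*m =
      trans (sym (ℕₚ.*-distribʳ-+ x j (m ∸ j))) (trans (cong (_* x) (ℕₚ.m+[n∸m]≡n j≤m)) (ℕₚ.*-comm m x))

  *-/-step : ∀ {x} j → x ≤ m → Σ ℕ λ s → s ≤ 1 × suc j * x / m ≡ s + j * x / m
  *-/-step {x} j x≤m =
    [ (λ below → 1 , ℕₚ.≤-refl , ℕₚ.≤-antisym upper below) , (λ equal → 0 , z≤n , sym equal) ]′
    (ℕₚ.m≤n⇒m<n∨m≡n lower)
    where
    lower : j * x / m ≤ suc j * x / m
    lower = /-monoˡ-≤ m (ℕₚ.m≤n+m (j * x) x)
    upper : suc j * x / m ≤ suc (j * x / m)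
    upper = begin
      (x + j * x) / m            ≤⟨ /-monoˡ-≤ m (ℕₚ.+-monoˡ-≤ (j * x) x≤m) ⟩
      (m + j * x) / m            ≡⟨ m/n≡1+[m∸n]/n (ℕₚ.m≤m+n m (j * x)) ⟩
      suc ((m + j * x ∸ m) / m)  ≡⟨ cong (λ n → suc (n / m)) (ℕₚ.m+n∸m≡n m (j * x)) ⟩
      suc (j * x / m)            ∎
      where open ℕₚ.≤-Reasoning

Δ² : (ℕ → ℕ) → ℕ → ℤ
Δ² f i = (+ f (i ∸ 1) ℤ.+ + f (i + 1)) ℤ.- (+ f i ℤ.+ + f i)

Near : ℕ → ℕ → Set
Near i j = i ∸ 1 ≤ j × j ≤ i + 1

module _ {i : ℕ} where

  near-pred : Near i (i ∸ 1)
  near-pred = ℕₚ.≤-refl , ℕₚ.≤-trans (ℕₚ.m∸n≤m i 1) (ℕₚ.m≤m+n i 1)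

  near-refl : Near i i
  near-refl = ℕₚ.m∸n≤m i 1 , ℕₚ.m≤m+n i 1

  near-suc : Near i (i + 1)
  near-suc = ℕₚ.≤-trans (ℕₚ.m∸n≤m i 1) (ℕₚ.m≤m+n i 1) , ℕₚ.≤-refl

  Δ²-cong : ∀ {f g} → (∀ {j} → Near i j → f j ≡ g j) → Δ² f i ≡ Δ² g i
  Δ²-cong f≡g = cong₂ ℤ._-_ (cong₂ ℤ._+_ (cong +_ (f≡g near-pred)) (cong +_ (f≡g near-suc)))
                            (cong₂ ℤ._+_ (cong +_ (f≡g near-refl)) (cong +_ (f≡g near-refl)))

  Δ²-+ : ∀ f g → Δ² (λ j → f j + g j) i ≡ Δ² f i ℤ.+ Δ² g i
  Δ²-+ f g
    rewrite ℤₚ.pos-+ (f (i ∸ 1)) (g (i ∸ 1)) | ℤₚ.pos-+ (f i) (g i) | ℤₚ.pos-+ (f (i + 1)) (g (i + 1))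
    = regroup (+ f (i ∸ 1)) (+ g (i ∸ 1)) (+ f i) (+ g i) (+ f (i + 1)) (+ g (i + 1))
    where
    regroup : ∀ a a' b b' c c' →
      ((a ℤ.+ a') ℤ.+ (c ℤ.+ c')) ℤ.- ((b ℤ.+ b') ℤ.+ (b ℤ.+ b'))
        ≡ ((a ℤ.+ c) ℤ.- (b ℤ.+ b)) ℤ.+ ((a' ℤ.+ c') ℤ.- (b' ℤ.+ b'))
    regroup = ℤ-Solver.solve-∀

  Δ²-const : ∀ n → Δ² (λ _ → n) i ≡ + 0
  Δ²-const n = ℤₚ.+-inverseʳ (+ n ℤ.+ + n)

  Δ²-id : 1 ≤ i → Δ² (λ j → j) i ≡ + 0
  Δ²-id 1≤i = begin
    (+ (i ∸ 1) ℤ.+ + (i + 1)) ℤ.- (+ i ℤ.+ + i)  ≡⟨ cong (ℤ._- (+ i ℤ.+ + i)) (ℤₚ.pos-+ (i ∸ 1) (i + 1)) ⟨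
    + (i ∸ 1 + (i + 1)) ℤ.- (+ i ℤ.+ + i)
      ≡⟨ cong (ℤ._- (+ i ℤ.+ + i)) (trans (cong +_ (balance 1≤i)) (ℤₚ.pos-+ i i)) ⟩
    (+ i ℤ.+ + i) ℤ.- (+ i ℤ.+ + i)              ≡⟨ ℤₚ.+-inverseʳ (+ i ℤ.+ + i) ⟩
    + 0                                          ∎
    where
    open ≡-Reasoning
    balance : ∀ {n} → 1 ≤ n → n ∸ 1 + (n + 1) ≡ n + n
    balance {suc n} _ = trans (cong (_+_ n) (ℕₚ.+-comm (suc n) 1)) (ℕₚ.+-suc n (suc n))

  Δ²-complement : ∀ {f g h} → (∀ {j} → Near i j → f j + g j ≡ h j) → Δ² g i ≡ Δ² h i ℤ.- Δ² f i
  Δ²-complement {f} {g} {h} f+g≡h = begin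
    Δ² g i                             ≡⟨ cancel (Δ² f i) (Δ² g i) ⟩
    (Δ² f i ℤ.+ Δ² g i) ℤ.- Δ² f i     ≡⟨ cong (ℤ._- Δ² f i) (Δ²-+ f g) ⟨
    Δ² (λ j → f j + g j) i ℤ.- Δ² f i  ≡⟨ cong (ℤ._- Δ² f i) (Δ²-cong f+g≡h) ⟩
    Δ² h i ℤ.- Δ² f i                  ∎
    where
    open ≡-Reasoning
    cancel : ∀ a b → b ≡ (a ℤ.+ b) ℤ.- a
    cancel = ℤ-Solver.solve-∀

  Δ²-suc : ∀ f → Δ² (λ j → suc (f j)) i ≡ Δ² f i
  Δ²-suc f = trans (Δ²-+ (λ _ → 1) f) (trans (cong (ℤ._+ Δ² f i) (Δ²-const 1)) (ℤₚ.+-identityˡ (Δ² f i)))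

  Δ²-reflect : ∀ m {f} n → (∀ {j} → Near i j → f j + f (m ∸ j) ≡ n) → Δ² (λ j → f (m ∸ j)) i ≡ ℤ.- Δ² f i
  Δ²-reflect m {f} n f+f∘reflect≡n =
    trans (Δ²-complement {f} {λ j → f (m ∸ j)} {λ _ → n} f+f∘reflect≡n)
          (trans (cong (ℤ._- Δ² f i) (Δ²-const n)) (ℤₚ.+-identityˡ (ℤ.- Δ² f i)))

toℚ-Δ² : ∀ {W : ℕ → ℚ} ψ {i} → (∀ {j} → Near i j → W j ≡ toℚ (+ ψ j)) →
         (W (i ∸ 1) ℚ.+ W (i + 1)) ℚ.- (1ℚ ℚ.+ 1ℚ) ℚ.* W i ≡ toℚ (Δ² ψ i)
toℚ-Δ² {W} ψ {i} W≡ψ = begin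
  (W (i ∸ 1) ℚ.+ W (i + 1)) ℚ.- (1ℚ ℚ.+ 1ℚ) ℚ.* W i
    ≡⟨ cong₂ (λ A C → A ℚ.- (1ℚ ℚ.+ 1ℚ) ℚ.* C)
             (cong₂ ℚ._+_ (W≡ψ near-pred) (W≡ψ near-suc)) (W≡ψ near-refl) ⟩
  (toℚ x ℚ.+ toℚ y) ℚ.- (1ℚ ℚ.+ 1ℚ) ℚ.* toℚ z   ≡⟨ cong (ℚ._-_ (toℚ x ℚ.+ toℚ y)) twice ⟩
  (toℚ x ℚ.+ toℚ y) ℚ.- (toℚ z ℚ.+ toℚ z)       ≡⟨ cong₂ ℚ._-_ (toℚ-+ x y) (toℚ-+ z z) ⟨
  toℚ (x ℤ.+ y) ℚ.- toℚ (z ℤ.+ z)               ≡⟨ toℚ-- (x ℤ.+ y) (z ℤ.+ z) ⟨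
  toℚ (Δ² ψ i)                                  ∎
  where
  open ≡-Reasoning
  x = + ψ (i ∸ 1)
  y = + ψ (i + 1)
  z = + ψ i
  twice : (1ℚ ℚ.+ 1ℚ) ℚ.* toℚ z ≡ toℚ z ℚ.+ toℚ z
  twice = trans (ℚₚ.*-distribʳ-+ (toℚ z) 1ℚ 1ℚ)
                (cong₂ ℚ._+_ (ℚₚ.*-identityˡ (toℚ z)) (ℚₚ.*-identityˡ (toℚ z)))

data Trit : ℤ → Set where
  negative : Trit -[1+ 0 ]
  null     : Trit (+ 0)
  positive : Trit (+ 1)

trit-difference : ∀ {s s'} → s ≤ 1 → s' ≤ 1 → Trit (+ s' ℤ.- + s)
trit-difference z≤n       z≤n       = null
trit-difference z≤n       (s≤s z≤n) = positive
trit-difference (s≤s z≤n) z≤n       = negative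
trit-difference (s≤s z≤n) (s≤s z≤n) = null

Δ²-unitSteps : ∀ f i → 1 ≤ i → (∀ j → Σ ℕ λ s → s ≤ 1 × f (suc j) ≡ s + f j) → Trit (Δ² f i)
Δ²-unitSteps f (suc i) _ steps with steps i | steps (suc i)
... | s , s≤1 , f[1+i]≡s+f[i] | s' , s'≤1 , f[2+i]≡s'+f[1+i] =
  subst Trit (sym Δ²≡s'-s) (trit-difference s≤1 s'≤1)
  where
  x = f i
  Δ²≡s'-s : Δ² f (suc i) ≡ + s' ℤ.- + s
  Δ²≡s'-s = begin
    (+ x ℤ.+ + f (suc i + 1)) ℤ.- (+ f (suc i) ℤ.+ + f (suc i))
      ≡⟨ cong₂ (λ y z → (+ x ℤ.+ + y) ℤ.- (+ z ℤ.+ + z))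
           (trans (cong f (ℕₚ.+-comm (suc i) 1)) (trans f[2+i]≡s'+f[1+i] (cong (_+_ s') f[1+i]≡s+f[i])))
           f[1+i]≡s+f[i] ⟩
    (+ x ℤ.+ + (s' + (s + x))) ℤ.- (+ (s + x) ℤ.+ + (s + x))
      ≡⟨ cong₂ (λ y z → (+ x ℤ.+ y) ℤ.- (z ℤ.+ z))
           (trans (ℤₚ.pos-+ s' (s + x)) (cong (ℤ._+_ (+ s')) (ℤₚ.pos-+ s x))) (ℤₚ.pos-+ s x) ⟩
    (+ x ℤ.+ (+ s' ℤ.+ (+ s ℤ.+ + x))) ℤ.- ((+ s ℤ.+ + x) ℤ.+ (+ s ℤ.+ + x))
      ≡⟨ collapse (+ x) (+ s) (+ s') ⟩
    + s' ℤ.- + s ∎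
    where
    open ≡-Reasoning
    collapse : ∀ x s s' → (x ℤ.+ (s' ℤ.+ (s ℤ.+ x))) ℤ.- ((s ℤ.+ x) ℤ.+ (s ℤ.+ x)) ≡ s' ℤ.- s
    collapse = ℤ-Solver.solve-∀

unitVec : ℕ → ℕ → ℤ
unitVec n c = if n ≡ᵇ c then + 1 else + 0

unitVec-self : ∀ n → unitVec n n ≡ + 1
unitVec-self n = cong (if_then + 1 else + 0) (dec-true (n ≟ n) refl)

unitVec-other : ∀ {n c} → n ≢ c → unitVec n c ≡ + 0
unitVec-other {n} {c} n≢c = cong (if_then + 1 else + 0) (dec-false (n ≟ c) n≢c)

0≤toℚ-unitVec : ∀ n c → 0ℚ ℚ.≤ toℚ (unitVec n c)
0≤toℚ-unitVec n c with n ≡ᵇ c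
... | true  = ℚₚ.nonNegative⁻¹ 1ℚ
... | false = ℚₚ.≤-refl

pick : ∀ {u} → Trit u → ℕ → ℕ → ℕ → ℤ
pick negative l r = unitVec r
pick null     l r = λ _ → + 0
pick positive l r = unitVec l

pick-away : ∀ {u} (τ : Trit u) {l r n} → l ≢ n → r ≢ n → pick τ l r n ≡ + 0
pick-away negative _   r≢n = unitVec-other r≢n
pick-away null     _   _   = refl
pick-away positive l≢n _   = unitVec-other l≢n

pick-differenceˡ : ∀ {u} (τ : Trit u) {l r} → l ≢ r → pick τ l r l ℤ.- pick τ r l l ≡ u
pick-differenceˡ negative {l} l≢r rewrite unitVec-other (l≢r ∘ sym) | unitVec-self l = refl
pick-differenceˡ null         l≢r = refl
pick-differenceˡ positive {l} l≢r rewrite unitVec-other (l≢r ∘ sym) | unitVec-self l = refl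

pick-differenceʳ : ∀ {u} (τ : Trit u) {l r} → l ≢ r → pick τ l r r ℤ.- pick τ r l r ≡ ℤ.- u
pick-differenceʳ negative {r = r} l≢r rewrite unitVec-other l≢r | unitVec-self r = refl
pick-differenceʳ null             l≢r = refl
pick-differenceʳ positive {r = r} l≢r rewrite unitVec-other l≢r | unitVec-self r = refl

module _ {k m : ℕ} {a b : ℕ → ℕ} where

  InP-cong : ∀ {x y} → (∀ c → y c ≡ x c) → InP k m a b x → InP k m a b y
  InP-cong y≡x (λs , 0≤λs , Σλs≡1 , x≡Σ) = λs , 0≤λs , Σλs≡1 , λ c → trans (y≡x c) (x≡Σ c)

  vertex-InP : ∀ t → InP k m a b (vertex k m a b t)
  vertex-InP t = λs , (λ s → 0≤toℚ-unitVec (toℕ t) (toℕ s)) , Σλs≡1 , vertex≡Σ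
    where
    λs : Fin (suc (dim k)) → ℚ
    λs s = toℚ (unitVec (toℕ t) (toℕ s))
    λs-other : ∀ s → s ≢ t → λs s ≡ 0ℚ
    λs-other s s≢t = cong toℚ (unitVec-other (s≢t ∘ Finₚ.toℕ-injective ∘ sym))
    λs-self : λs t ≡ 1ℚ
    λs-self = cong toℚ (unitVec-self (toℕ t))
    Σλs≡1 : sumℚ λs ≡ 1ℚ
    Σλs≡1 = trans (sumℚ-single λs t λs-other) λs-self
    vertex≡Σ : ∀ c → vertex k m a b t c ≡ sumℚ (λ s → λs s ℚ.* vertex k m a b s c)
    vertex≡Σ c = sym (begin
      sumℚ (λ s → λs s ℚ.* V s)
        ≡⟨ sumℚ-single _ t (λ s s≢t → trans (cong (ℚ._* V s) (λs-other s s≢t)) (ℚₚ.*-zeroˡ (V s))) ⟩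
      λs t ℚ.* V t               ≡⟨ cong (ℚ._* V t) λs-self ⟩
      1ℚ ℚ.* V t                 ≡⟨ ℚₚ.*-identityˡ (V t) ⟩
      V t                        ∎)
      where
      open ≡-Reasoning
      V : Fin (suc (dim k)) → ℚ
      V s = vertex k m a b s c

  origin-InP : InP k m a b (λ _ → toℚ (+ 0))
  origin-InP = vertex-InP Fin.zero

  unitVec-InP : ∀ {n} → suc n < dim k → InP k m a b (λ c → toℚ (unitVec n (toℕ c)))
  unitVec-InP {n} 1+n<d = InP-cong unitVec≡vertex (vertex-InP (Fin.suc (fromℕ< n<d)))
    where
    n<d = ℕₚ.<-trans (ℕₚ.n<1+n n) 1+n<d
    unitVec≡vertex : ∀ c → toℚ (unitVec n (toℕ c)) ≡ vertex k m a b (Fin.suc (fromℕ< n<d)) c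
    unitVec≡vertex c rewrite Finₚ.toℕ-fromℕ< n<d | dec-false (suc n ≟ dim k) (ℕₚ.<⇒≢ 1+n<d) =
      if-float toℚ (n ≡ᵇ toℕ c)

  pick-InP : ∀ {u} (τ : Trit u) {l r} → suc l < dim k → suc r < dim k →
             InP k m a b (λ c → toℚ (pick τ l r (toℕ c)))
  pick-InP negative _     1+r<d = unitVec-InP 1+r<d
  pick-InP null     _     _     = origin-InP
  pick-InP positive 1+l<d _     = unitVec-InP 1+l<d

dim-suc : ∀ K → dim (suc K) ≡ suc (K + K)
dim-suc K = trans (ℕₚ.+-suc K (K + 0)) (cong (λ n → suc (K + n)) (ℕₚ.+-identityʳ K))

-- The 0-based coordinates of ℝ^(2K+1): left t and right t are the two coordinates built from the
-- pair (a (t + 1), b (t + 1)); in 1-based terms they are t + 1 and d - (t + 1).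
data Position (K : ℕ) : ℕ → Set where
  left  : (t : Fin K) → Position K (toℕ t)
  right : (t : Fin K) → Position K (K + toℕ (opposite t))
  last  : Position K (K + K)

position : ∀ K {n} → n < suc (K + K) → Position K n
position K {n} n<1+2K with n ℕ.<? K
... | yes n<K = subst (Position K) (Finₚ.toℕ-fromℕ< n<K) (left (fromℕ< n<K))
... | no  n≮K = subst (Position K) (ℕₚ.m+[n∸m]≡n K≤n) (upperHalf (n ∸ K) n∸K≤K)
  where
  K≤n : K ≤ n
  K≤n = ℕₚ.≮⇒≥ n≮K
  n∸K≤K : n ∸ K ≤ K
  n∸K≤K = subst (n ∸ K ≤_) (ℕₚ.m+n∸m≡n K K) (ℕₚ.∸-monoˡ-≤ K (ℕₚ.≤-pred n<1+2K))
  upperHalf : ∀ j → j ≤ K → Position K (K + j)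
  upperHalf j j≤K with ℕₚ.m≤n⇒m<n∨m≡n j≤K
  ... | inj₁ j<K = subst (λ o → Position K (K + o))
          (trans (cong toℕ (Finₚ.opposite-involutive (fromℕ< j<K))) (Finₚ.toℕ-fromℕ< j<K))
          (right (opposite (fromℕ< j<K)))
  ... | inj₂ refl = last

module Construction (K M : ℕ) (a b : ℕ → ℕ)
  (pairs : ∀ p → 1 ≤ p → p ≤ K → 1 ≤ a p × 1 ≤ b p × a p + b p ≡ suc M × gcd (a p) (suc M) ≡ 1)
  (i : ℕ) (2≤i : 2 ≤ i) (i≤m∸2 : i ≤ suc M ∸ 2) where

  m : ℕ
  m = suc M

  1≤i : 1 ≤ i
  1≤i = ℕₚ.≤-trans (s≤s z≤n) 2≤i

  near-inner : ∀ {j} → Near i j → 0 < j × j < m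
  near-inner (i∸1≤j , j≤i+1) = ℕₚ.≤-trans (ℕₚ.∸-monoˡ-≤ 1 2≤i) i∸1≤j , ℕₚ.≤-<-trans j≤i+1 i+1<m
    where
    2≤m : 2 ≤ m
    2≤m = ℕₚ.≤-trans 2≤i (ℕₚ.≤-trans i≤m∸2 (ℕₚ.m∸n≤m m 2))
    i+1<m : i + 1 < m
    i+1<m = subst (_≤ m) (ℕₚ.+-suc i 1)
      (ℕₚ.≤-trans (ℕₚ.+-monoˡ-≤ 2 i≤m∸2) (ℕₚ.≤-reflexive (ℕₚ.m∸n+n≡m 2≤m)))

  inner-reflect : ∀ {j} → 0 < j → j < m → 0 < m ∸ j × m ∸ j < m
  inner-reflect 0<j j<m = ℕₚ.m<n⇒0<n∸m j<m , ℕₚ.∸-monoʳ-< 0<j (ℕₚ.<⇒≤ j<m)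

  rightIndex : Fin K → ℕ
  rightIndex t = K + toℕ (opposite t)

  left<2K : ∀ (t : Fin K) → toℕ t < K + K
  left<2K t = ℕₚ.<-≤-trans (Finₚ.toℕ<n t) (ℕₚ.m≤m+n K K)

  K≤rightIndex : ∀ t → K ≤ rightIndex t
  K≤rightIndex t = ℕₚ.m≤m+n K (toℕ (opposite t))

  rightIndex<2K : ∀ t → rightIndex t < K + K
  rightIndex<2K t = ℕₚ.+-monoʳ-< K (Finₚ.toℕ<n (opposite t))

  rightIndex-injective : ∀ {s t} → rightIndex s ≡ rightIndex t → s ≡ t
  rightIndex-injective {s} {t} eq = begin
    s                      ≡⟨ Finₚ.opposite-involutive s ⟨
    opposite (opposite s)  ≡⟨ cong opposite (Finₚ.toℕ-injective (ℕₚ.+-cancelˡ-≡ K _ _ eq)) ⟩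
    opposite (opposite t)  ≡⟨ Finₚ.opposite-involutive t ⟩
    t                      ∎
    where open ≡-Reasoning

  left≢rightIndex : ∀ s t → toℕ s ≢ rightIndex t
  left≢rightIndex s t = ℕₚ.<⇒≢ (ℕₚ.<-≤-trans (Finₚ.toℕ<n s) (K≤rightIndex t))

  dim∸1 : dim (suc K) ∸ 1 ≡ K + K
  dim∸1 = cong (_∸ 1) (dim-suc K)

  dim∸rightIndex : ∀ t → dim (suc K) ∸ suc (rightIndex t) ≡ suc (toℕ t)
  dim∸rightIndex t = begin
    dim (suc K) ∸ suc (K + toℕ (opposite t))  ≡⟨ cong (_∸ suc (K + toℕ (opposite t))) (dim-suc K) ⟩
    (K + K) ∸ (K + toℕ (opposite t))          ≡⟨ ℕₚ.[m+n]∸[m+o]≡n∸o K K (toℕ (opposite t)) ⟩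
    K ∸ toℕ (opposite t)                      ≡⟨ cong (K ∸_) (Finₚ.opposite-prop t) ⟩
    K ∸ (K ∸ suc (toℕ t))                     ≡⟨ ℕₚ.m∸[m∸n]≡n (Finₚ.toℕ<n t) ⟩
    suc (toℕ t)                               ∎
    where open ≡-Reasoning

  W : ℕ → ℕ → ℚ
  W n j = wCoord (suc K) m a b j n

  W-left : ∀ t j → W (toℕ t) j ≡ frac (j * b (suc (toℕ t)) % m + j * a (suc (toℕ t))) m
  W-left t j rewrite dec-true (suc (toℕ t) ℕ.≤? K) (Finₚ.toℕ<n t) = refl

  W-right : ∀ t j → W (rightIndex t) j ≡ frac (j * a (suc (toℕ t)) % m + j * b (suc (toℕ t))) m
  W-right t j
    rewrite dec-false (suc (rightIndex t) ℕ.≤? K) (ℕₚ.<⇒≱ (s≤s (K≤rightIndex t)))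
          | dec-true (suc (rightIndex t) ℕ.≤? (dim (suc K) ∸ 1)) (subst (rightIndex t <_) (sym dim∸1) (rightIndex<2K t))
          | dim∸rightIndex t
    = refl

  W-last : ∀ j → W (K + K) j ≡ toℚ (+ j)
  W-last j
    rewrite dec-false (suc (K + K) ℕ.≤? K) (ℕₚ.<⇒≱ (s≤s (ℕₚ.m≤m+n K K)))
          | dec-false (suc (K + K) ℕ.≤? (dim (suc K) ∸ 1)) (ℕₚ.<-irrefl (sym dim∸1))
    = refl

  ceilFrac-reflect-inner : ∀ {x} → (∀ {j} → 0 < j → j < m → 0 < j * x % m) →
                           ∀ {j} → 0 < j → j < m → ceilFrac m x j + ceilFrac m x (m ∸ j) ≡ suc x
  ceilFrac-reflect-inner {x} 0<jx%m 0<j j<m = ceilFrac-reflect m x (ℕₚ.<⇒≤ j<m) (0<jx%m 0<j j<m)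

  module Pair (t : Fin K) where

    α β : ℕ
    α = a (suc (toℕ t))
    β = b (suc (toℕ t))

    α+β≡m : α + β ≡ m
    α+β≡m = proj₁ (proj₂ (proj₂ (pairs (suc (toℕ t)) (s≤s z≤n) (Finₚ.toℕ<n t))))

    0<jα%m : ∀ {j} → 0 < j → j < m → 0 < j * α % m
    0<jα%m = gcd≡1⇒0<*% m (proj₂ (proj₂ (proj₂ (pairs (suc (toℕ t)) (s≤s z≤n) (Finₚ.toℕ<n t)))))

    0<jβ%m : ∀ {j} → 0 < j → j < m → 0 < j * β % m
    0<jβ%m {j} 0<j j<m = %-complement-pos m (j * α) (j * β) j (*-complement m α+β≡m j) (0<jα%m 0<j j<m)

    W-leftᵢ : ∀ {j} → 0 < j → j < m → W (toℕ t) j ≡ toℚ (+ ceilFrac m α j)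
    W-leftᵢ {j} 0<j j<m = begin
      W (toℕ t) j                           ≡⟨ W-left t j ⟩
      frac (j * β % m + j * α) m            ≡⟨ cong (λ n → frac n m) (ceilFrac-numerator m α+β≡m j (0<jα%m 0<j j<m)) ⟩
      frac (ceilFrac m α j * m) m           ≡⟨ frac-multiple (ceilFrac m α j) M ⟩
      toℚ (+ ceilFrac m α j)                ∎
      where open ≡-Reasoning

    W-rightᵢ : ∀ {j} → 0 < j → j < m → W (rightIndex t) j ≡ toℚ (+ ceilFrac m β j)
    W-rightᵢ {j} 0<j j<m = begin
      W (rightIndex t) j                    ≡⟨ W-right t j ⟩
      frac (j * α % m + j * β) m            ≡⟨ cong (λ n → frac n m) (ceilFrac-numerator m β+α≡m j (0<jβ%m 0<j j<m)) ⟩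
      frac (ceilFrac m β j * m) m           ≡⟨ frac-multiple (ceilFrac m β j) M ⟩
      toℚ (+ ceilFrac m β j)                ∎
      where
      open ≡-Reasoning
      β+α≡m = trans (ℕₚ.+-comm β α) α+β≡m

    u : ℤ
    u = Δ² (λ j → j * α / m) i

    τ : Trit u
    τ = Δ²-unitSteps (λ j → j * α / m) i 1≤i (λ j → *-/-step m j (subst (α ≤_) α+β≡m (ℕₚ.m≤m+n α β)))

    Δ²-left : Δ² (ceilFrac m α) i ≡ u
    Δ²-left = Δ²-suc {i} (λ j → j * α / m)

    Δ²-right : Δ² (ceilFrac m β) i ≡ ℤ.- u
    Δ²-right = begin
      Δ² (ceilFrac m β) i                     ≡⟨ Δ²-suc {i} (λ j → j * β / m) ⟩
      Δ² (λ j → j * β / m) i                  ≡⟨ Δ²-complement {i} {f = ceilFrac m α} {h = λ j → j} sum≡j ⟩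
      Δ² (λ j → j) i ℤ.- Δ² (ceilFrac m α) i  ≡⟨ cong₂ ℤ._-_ (Δ²-id {i} 1≤i) Δ²-left ⟩
      + 0 ℤ.- u                               ≡⟨ ℤₚ.+-identityˡ (ℤ.- u) ⟩
      ℤ.- u                                   ∎
      where
      open ≡-Reasoning
      sum≡j : ∀ {j} → Near i j → ceilFrac m α j + j * β / m ≡ j
      sum≡j {j} near = ceilFrac-+-/ m α+β≡m j (0<jα%m (proj₁ (near-inner near)) (proj₂ (near-inner near)))

  -- A point of A is a sum of k = K + 1 points of P, one more than there are pairs.
  summand : (Fin K → ℕ) → (Fin K → ℕ) → Fin (suc K) → ℕ → ℤ
  summand l r Fin.zero    = λ _ → + 0
  summand l r (Fin.suc t) = pick (Pair.τ t) (l t) (r t)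

  vector : (Fin K → ℕ) → (Fin K → ℕ) → ℕ → ℤ
  vector l r n = sumℤ (λ s → summand l r s n)

  vector-InA : ∀ {l r} → (∀ t → l t < K + K) → (∀ t → r t < K + K) →
               InA (suc K) m a b (λ c → vector l r (toℕ c))
  vector-InA {l} {r} l<2K r<2K = (λ s c → summand l r s (toℕ c)) , summand-InP , λ _ → refl
    where
    inside : ∀ {n} → n < K + K → suc n < dim (suc K)
    inside {n} n<2K = subst (suc n <_) (sym (dim-suc K)) (s≤s n<2K)
    summand-InP : ∀ s → InP (suc K) m a b (λ c → toℚ (summand l r s (toℕ c)))
    summand-InP Fin.zero    = origin-InP {suc K} {m} {a} {b}
    summand-InP (Fin.suc t) = pick-InP {suc K} {m} {a} {b} (Pair.τ t) (inside (l<2K t)) (inside (r<2K t))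

  vector-single : ∀ l r n t₀ → (∀ t → t ≢ t₀ → l t ≢ n × r t ≢ n) →
                  vector l r n ≡ pick (Pair.τ t₀) (l t₀) (r t₀) n
  vector-single l r n t₀ away = trans (ℤₚ.+-identityˡ _) (sumℤ-single _ t₀ λ t t≢t₀ →
    pick-away (Pair.τ t) (proj₁ (away t t≢t₀)) (proj₂ (away t t≢t₀)))

  vector-zero : ∀ l r n → (∀ t → l t ≢ n × r t ≢ n) → vector l r n ≡ + 0
  vector-zero l r n away = trans (ℤₚ.+-identityˡ _) (sumℤ-zero _ λ t →
    pick-away (Pair.τ t) (proj₁ (away t)) (proj₂ (away t)))

  v v' : ℕ → ℤ
  v  = vector toℕ rightIndex
  v' = vector rightIndex toℕ

  v-v'-left : ∀ t → v (toℕ t) ℤ.- v' (toℕ t) ≡ Pair.u t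
  v-v'-left t =
    trans (cong₂ ℤ._-_ (vector-single _ _ _ t away) (vector-single _ _ _ t (λ s s≢t → swap (away s s≢t))))
          (pick-differenceˡ (Pair.τ t) (left≢rightIndex t t))
    where
    away : ∀ s → s ≢ t → toℕ s ≢ toℕ t × rightIndex s ≢ toℕ t
    away s s≢t = s≢t ∘ Finₚ.toℕ-injective , left≢rightIndex t s ∘ sym

  v-v'-right : ∀ t → v (rightIndex t) ℤ.- v' (rightIndex t) ≡ ℤ.- Pair.u t
  v-v'-right t =
    trans (cong₂ ℤ._-_ (vector-single _ _ _ t away) (vector-single _ _ _ t (λ s s≢t → swap (away s s≢t))))
          (pick-differenceʳ (Pair.τ t) (left≢rightIndex t t))
    where
    away : ∀ s → s ≢ t → toℕ s ≢ rightIndex t × rightIndex s ≢ rightIndex t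
    away s s≢t = left≢rightIndex s t , s≢t ∘ rightIndex-injective

  v-v'-last : v (K + K) ℤ.- v' (K + K) ≡ + 0
  v-v'-last = cong₂ ℤ._-_ (vector-zero _ _ _ away) (vector-zero _ _ _ (swap ∘ away))
    where
    away : ∀ t → toℕ t ≢ K + K × rightIndex t ≢ K + K
    away t = ℕₚ.<⇒≢ (left<2K t) , ℕₚ.<⇒≢ (rightIndex<2K t)

  CoordinateGoal : ℕ → Set
  CoordinateGoal n =
    (W n (i ∸ 1) ℚ.+ W n (i + 1)) ℚ.- (1ℚ ℚ.+ 1ℚ) ℚ.* W n i ≡ toℚ (v n) ℚ.- toℚ (v' n) ×
    (W n (m ∸ (i ∸ 1)) ℚ.+ W n (m ∸ (i + 1))) ℚ.- (1ℚ ℚ.+ 1ℚ) ℚ.* W n (m ∸ i) ≡ toℚ (v' n) ℚ.- toℚ (v n)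

  integral-coordinate : ∀ {n} (ψ : ℕ → ℕ) {C : ℕ} →
    (∀ {j} → 0 < j → j < m → W n j ≡ toℚ (+ ψ j)) →
    (∀ {j} → 0 < j → j < m → ψ j + ψ (m ∸ j) ≡ C) →
    Δ² ψ i ≡ v n ℤ.- v' n →
    CoordinateGoal n
  integral-coordinate {n} ψ {C} W≡ψ ψ+ψ∘reflect≡C Δ²ψ≡v-v' =
    trans (toℚ-Δ² ψ at) (trans (cong toℚ Δ²ψ≡v-v') (toℚ-- (v n) (v' n))) ,
    trans (toℚ-Δ² (λ j → ψ (m ∸ j)) at-reflected) (trans (cong toℚ Δ²ψ∘reflect≡v'-v) (toℚ-- (v' n) (v n)))
    where
    at : ∀ {j} → Near i j → W n j ≡ toℚ (+ ψ j)
    at near = W≡ψ (proj₁ (near-inner near)) (proj₂ (near-inner near))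
    at-reflected : ∀ {j} → Near i j → W n (m ∸ j) ≡ toℚ (+ ψ (m ∸ j))
    at-reflected near = let (0<j , j<m) = near-inner near in
      W≡ψ (proj₁ (inner-reflect 0<j j<m)) (proj₂ (inner-reflect 0<j j<m))
    swap-minus : ∀ x y → ℤ.- (x ℤ.- y) ≡ y ℤ.- x
    swap-minus = ℤ-Solver.solve-∀
    Δ²ψ∘reflect≡v'-v : Δ² (λ j → ψ (m ∸ j)) i ≡ v' n ℤ.- v n
    Δ²ψ∘reflect≡v'-v = begin
      Δ² (λ j → ψ (m ∸ j)) i
        ≡⟨ Δ²-reflect {i} m {ψ} C (λ near → ψ+ψ∘reflect≡C (proj₁ (near-inner near)) (proj₂ (near-inner near))) ⟩
      ℤ.- Δ² ψ i              ≡⟨ cong ℤ.-_ Δ²ψ≡v-v' ⟩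
      ℤ.- (v n ℤ.- v' n)      ≡⟨ swap-minus (v n) (v' n) ⟩
      v' n ℤ.- v n            ∎
      where open ≡-Reasoning

  coordinate : ∀ {n} → Position K n → CoordinateGoal n
  coordinate (left t) = integral-coordinate (ceilFrac m α) W-leftᵢ (ceilFrac-reflect-inner 0<jα%m)
    (trans Δ²-left (sym (v-v'-left t)))
    where open Pair t
  coordinate (right t) = integral-coordinate (ceilFrac m β) W-rightᵢ (ceilFrac-reflect-inner 0<jβ%m)
    (trans Δ²-right (sym (v-v'-right t)))
    where open Pair t
  coordinate last = integral-coordinate (λ j → j) (λ {j} _ _ → W-last j) (λ _ j<m → ℕₚ.m+[n∸m]≡n (ℕₚ.<⇒≤ j<m))
    (trans (Δ²-id {i} 1≤i) (sym v-v'-last))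

lemma3p2 : (k m : ℕ) (a b : ℕ → ℕ) →
    2 ≤ k → 2 ≤ m →
    (∀ i → 1 ≤ i → i ≤ k ∸ 1 → 1 ≤ a i × 1 ≤ b i × a i + b i ≡ m × gcd (a i) m ≡ 1) →
    ∀ i → 2 ≤ i → i ≤ m ∸ 2 →
    Σ (_ → ℤ) λ v → Σ (_ → ℤ) λ v' →
      InA k m a b v × InA k m a b v' ×
      (∀ c → (w k m a b (i ∸ 1) c ℚ.+ w k m a b (i + 1) c) ℚ.- (1ℚ ℚ.+ 1ℚ) ℚ.* w k m a b i c
               ≡ toℚ (v c) ℚ.- toℚ (v' c)) ×
      (∀ c → (w k m a b (m ∸ (i ∸ 1)) c ℚ.+ w k m a b (m ∸ (i + 1)) c) ℚ.- (1ℚ ℚ.+ 1ℚ) ℚ.* w k m a b (m ∸ i) c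
               ≡ toℚ (v' c) ℚ.- toℚ (v c))
lemma3p2 (suc (suc K)) (suc (suc M)) a b (s≤s (s≤s _)) (s≤s (s≤s _)) pairs i 2≤i i≤m∸2 =
  v ∘ toℕ , v' ∘ toℕ ,
  vector-InA left<2K rightIndex<2K , vector-InA rightIndex<2K left<2K ,
  proj₁ ∘ goal , proj₂ ∘ goal
  where
  open Construction (suc K) (suc M) a b pairs i 2≤i i≤m∸2
  goal : ∀ c → CoordinateGoal (toℕ c)
  goal c = coordinate (position (suc K) (subst (toℕ c <_) (dim-suc (suc K)) (Finₚ.toℕ<n c)))
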